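{- Let $H=\mathbb{K}[(1)]$ and $C=T\langle(0,n),n\in\mathbb{N}^*\rangle$ be as in the context. The linear map $\rho:C\to C\otimes H$ defined by $\rho(1_C)=1_C\otimes1_H$ and, for $q\ge1$ and $n_1,\dots,n_q\ge1$, $$\rho((0,n_1,\dots,n_q))=\sum_{s=q}^{n_1+\dots+n_q-1}\sum_{\substack{k_1+\dots+k_q=s\\1\le k_j\le n_j}}\binom{n_1}{k_1}\cdots\binom{n_q}{k_q}(0,k_1,\dots,k_q)\otimes\Big(\sum_{j=1}^q(n_j-k_j)\Big)+(0,n_1,\dots,n_q)\otimes1_H,$$ makes $(C,\rho)$ a right $H$-comodule, i.e. $(\rho\otimes\mathrm{Id}_H)\circ\rho=(\mathrm{Id}_C\otimes\Delta_H)\circ\rho$ and $(\mathrm{Id}_C\otimes\varepsilon_H)\circ\rho=\mathrm{Id}_C$.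
   Context: $\mathbb{K}$ is a field of characteristic $0$. $H=\mathbb{K}[(1)]$ is the polynomial Hopf algebra in one primitive generator $(1)$; for $m\ge0$, $(m)$ denotes $(1)^m$ (so $(0)=1_H$ and $(k)(l)=(k+l)$), and $\Delta_H((1))=(1)\otimes1_H+1_H\otimes(1)$. $C=T\langle(0,n),n\in\mathbb{N}^*\rangle$ is the tensor (free associative) algebra on generators $(0,n)$, $n\ge1$; its basis elements are written $(0,n_1,\dots,n_q)$ for the product $(0,n_1)\cdots(0,n_q)$ ($q\ge0$, the case $q=0$ being $1_C$), the product being concatenation $(0,n_1,\dots,n_k)(0,m_1,\dots,m_s)=(0,n_1,\dots,n_k,m_1,\dots,m_s)$; the coproduct $\Delta_C$ is the algebra morphism making every $(0,n)$ primitive. -}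

module Defs where

open import Level using (Level; _⊔_)
open import Algebra.Bundles using (CommutativeRing)
open import Data.Nat as ℕ using (ℕ; zero; suc; _∸_)
open import Data.Nat.Combinatorics using (_C_)
open import Data.List as List using (List; []; _∷_; map; concatMap; upTo; filterᵇ; foldr)
import Data.List.Properties as ListP
open import Data.Product using (_×_; _,_; Σ)
import Data.Product.Properties as ProdP
open import Relation.Nullary using (¬_; yes; no)
open import Relation.Binary.Definitions using (DecidableEquality)
open import Relation.Binary.PropositionalEquality using (_≡_)

module _ {c ℓ} (R : CommutativeRing c ℓ) where
  open CommutativeRing R
  ℕ→R : ℕ → Carrier
  ℕ→R zero    = 0#
  ℕ→R (suc n) = 1# + ℕ→R n

record IsField {c ℓ} (K : CommutativeRing c ℓ) : Set (c ⊔ ℓ) where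
  open CommutativeRing K
  field
    1≉0     : ¬ (1# ≈ 0#)
    inverse : ∀ x → ¬ (x ≈ 0#) → Σ Carrier (λ y → (x * y) ≈ 1#)

CharacteristicZero : ∀ {c ℓ} (K : CommutativeRing c ℓ) → Set ℓ
CharacteristicZero K = ∀ n → ¬ (ℕ→R K (suc n) ≈ 0#)
  where open CommutativeRing K

-- The vector spaces C, C ⊗ H, C ⊗ H ⊗ H over K, as free K-modules on
-- their monomial bases, represented by finite formal linear combinations.
--
-- Basis of C: words (0,n₁,…,n_q) with nᵢ ≥ 1.  A word is encoded as a
-- List ℕ of PREDECESSORS: the list p₁ ∷ … ∷ p_q encodes (0, suc p₁, …, suc p_q).
-- Basis of H: (m) = (1)^m, encoded by m : ℕ.

Word : Set
Word = List ℕ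

module Comodule {c ℓ} (K : CommutativeRing c ℓ) where
  open CommutativeRing K

  FS : Set → Set c
  FS B = List (Carrier × B)

  coeff : {B : Set} → DecidableEquality B → FS B → B → Carrier
  coeff _≟_ []             b = 0#
  coeff _≟_ ((a , b′) ∷ xs) b with b′ ≟ b
  ... | yes _ = a + coeff _≟_ xs b
  ... | no  _ = coeff _≟_ xs b

  Eq : {B : Set} → DecidableEquality B → FS B → FS B → Set (ℓ)
  Eq _≟_ x y = ∀ b → coeff _≟_ x b ≈ coeff _≟_ y b

  linExt : {A B : Set} → (A → FS B) → FS A → FS B
  linExt f xs = concatMap (λ { (a , x) → map (λ { (d , y) → (a * d , y) }) (f x) }) xs

  C⊗H-basis : Set
  C⊗H-basis = Word × ℕ

  C⊗H⊗H-basis : Set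
  C⊗H⊗H-basis = Word × ℕ × ℕ

  _≟W_ : DecidableEquality Word
  _≟W_ = ListP.≡-dec ℕ._≟_

  _≟C_ : DecidableEquality Word
  _≟C_ = _≟W_

  _≟CH_ : DecidableEquality C⊗H-basis
  _≟CH_ = ProdP.≡-dec _≟W_ ℕ._≟_

  _≟CHH_ : DecidableEquality C⊗H⊗H-basis
  _≟CHH_ = ProdP.≡-dec _≟W_ (ProdP.≡-dec ℕ._≟_ ℕ._≟_)

  _≋C_ : FS Word → FS Word → Set ℓ
  _≋C_ = Eq _≟C_

  _≋CHH_ : FS C⊗H⊗H-basis → FS C⊗H⊗H-basis → Set ℓ
  _≋CHH_ = Eq _≟CHH_

  -- The Hopf algebra H = K[(1)]: coproduct and counit, as the algebra
  -- morphisms with Δ((1)) = (1)⊗1 + 1⊗(1) and ε((1)) = 0.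

  mulHH : FS (ℕ × ℕ) → FS (ℕ × ℕ) → FS (ℕ × ℕ)
  mulHH xs ys = concatMap (λ { (a , (i , j)) →
                  map (λ { (b , (k , l)) → (a * b , (i ℕ.+ k , j ℕ.+ l)) }) ys }) xs

  Δ1 : FS (ℕ × ℕ)
  Δ1 = (1# , (1 , 0)) ∷ (1# , (0 , 1)) ∷ []

  ΔH : ℕ → FS (ℕ × ℕ)
  ΔH zero    = (1# , (0 , 0)) ∷ []
  ΔH (suc m) = mulHH Δ1 (ΔH m)

  εH : ℕ → Carrier
  εH zero    = 1#
  εH (suc m) = 0# * εH m

  -- all tuples (k₁,…,k_q) with 1 ≤ k_j ≤ n_j, in predecessor encoding
  -- (entry j ranges over 0 … p_j, where n_j = suc p_j)
  tuples : Word → List Word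
  tuples []       = [] ∷ []
  tuples (p ∷ ps) = concatMap (λ j → map (j ∷_) (tuples ps)) (upTo (suc p))

  weight : Word → ℕ
  weight = foldr (λ p s → suc p ℕ.+ s) 0

  binomProd : Word → Word → ℕ
  binomProd (p ∷ ps) (j ∷ js) = (suc p C suc j) ℕ.* binomProd ps js
  binomProd _        _        = 1

  tuplesWithSum : Word → ℕ → List Word
  tuplesWithSum w s = filterᵇ (λ k → weight k ℕ.≡ᵇ s) (tuples w)

  -- the range q, q+1, …, N-1  (empty if N-1 < q)
  range : ℕ → ℕ → List ℕ
  range lo hi = map (lo ℕ.+_) (upTo (suc hi ∸ lo))

  ρ-basis : Word → FS C⊗H-basis
  ρ-basis [] = (1# , ([] , 0)) ∷ []
  ρ-basis w@(_ ∷ _) =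
    concatMap (λ s → map (λ k → (ℕ→R K (binomProd w k) , (k , weight w ∸ s)))
                         (tuplesWithSum w s))
              (range (List.length w) (weight w ∸ 1))
    List.++ ((1# , (w , 0)) ∷ [])

  ρ : FS Word → FS C⊗H-basis
  ρ = linExt ρ-basis

  ρ⊗Id : FS C⊗H-basis → FS C⊗H⊗H-basis
  ρ⊗Id = linExt (λ { (w , m) → map (λ { (d , (w′ , i)) → (d , (w′ , i , m)) }) (ρ-basis w) })

  Id⊗Δ : FS C⊗H-basis → FS C⊗H⊗H-basis
  Id⊗Δ = linExt (λ { (w , m) → map (λ { (d , (i , j)) → (d , (w , i , j)) }) (ΔH m) })

  Id⊗ε : FS C⊗H-basis → FS Word
  Id⊗ε = linExt (λ { (w , m) → (εH m , w) ∷ [] })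

-- A formal combination is determined by its pairings ⟨ X ∣ φ ⟩ with arbitrary
-- functionals φ on the basis, so both identities are checked after pairing.
-- The sum over s and over tuples of weight s in ρ(0,n₁,…,n_q) is just the sum over
-- all tuples 1 ≤ k_j ≤ n_j, which factorises over the letters: ρ is multiplicative
-- with ρ(0,n) = ∑_k C(n,k) (0,k) ⊗ (n−k).  For a single letter, coassociativity is
-- C(n,k) C(k,l) = C(n,l) C(n−l,k−l) combined with Δ_H((m)) = ∑_a C(m,a) (a) ⊗ (m−a);
-- multiplicativity of ρ and of Δ_H extends it to words.  Counitality keeps only the
-- term k = n.  Nothing beyond K being a commutative ring is used.

module Submission where

open import Defs
open import Level using (Level)
open import Algebra.Bundles using (CommutativeRing; Semiring)
open import Data.Bool using (Bool; true; false; T; if_then_else_)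
open import Data.Empty using (⊥-elim)
open import Data.List using (List; []; _∷_; _++_; _∷ʳ_; map; concatMap; filterᵇ; upTo; applyUpTo; length)
open import Data.List.Properties using (upTo-∷ʳ; map-++; map-upTo; concatMap-++; ++-identityʳ; ++-assoc)
open import Data.List.Relation.Unary.All using (All; []; _∷_)
import Data.List.Relation.Unary.All as All
import Data.List.Relation.Unary.All.Properties as All
open import Data.Nat as ℕ using (ℕ; zero; suc; _≡ᵇ_; _≤_; _<_; _∸_; _!; z≤n; s≤s)
import Data.Nat.Properties as ℕ
open import Data.Nat.Combinatorics using (_C_; nCk≡n!/k![n-k]!; k![n∸k]!∣n!; nCn≡1; nCk+nC[k+1]≡[n+1]C[k+1]; k>n⇒nCk≡0)
open import Data.Nat.DivMod using (m/n*n≡m)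
open import Data.Nat.Solver using (module +-*-Solver)
open import Data.Product using (_×_; _,_; Σ-syntax; proj₁; proj₂)
open import Data.Sum using (inj₁; inj₂)
open import Data.Unit using (tt)
open import Relation.Nullary using (yes; no)
open import Relation.Binary.Definitions using (DecidableEquality)
open import Relation.Binary.PropositionalEquality as ≡ using (_≡_; _≢_)
import Relation.Binary.Reasoning.Setoid as SetoidReasoning

module Arithmetic where

  open import Data.Nat using (_+_; _*_)

  nCk*k!*[n∸k]!≡n! : ∀ {n k} → k ≤ n → (n C k) * (k ! * (n ∸ k) !) ≡ n !
  nCk*k!*[n∸k]!≡n! {n} {k} k≤n = ≡.trans (≡.cong (_* (k ! * (n ∸ k) !)) (nCk≡n!/k![n-k]! k≤n))
    (m/n*n≡m {{ℕ._!*_!≢0 k (n ∸ k)}} (k![n∸k]!∣n! k≤n))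

  [m+n]Cm*m!*n!≡[m+n]! : ∀ m n → ((m + n) C m) * (m ! * n !) ≡ (m + n) !
  [m+n]Cm*m!*n!≡[m+n]! m n =
    ≡.subst (λ k → ((m + n) C m) * (m ! * k !) ≡ (m + n) !) (ℕ.m+n∸m≡n m n) (nCk*k!*[n∸k]!≡n! (ℕ.m≤m+n m n))

  -- C(n,k) C(k,j) = C(n,j) C(n−j,k−j), with n = j + a + b and k = j + a.
  subset-of-subset : ∀ j a b → ((j + a + b) C (j + a)) * ((j + a) C j) ≡ ((j + a + b) C j) * ((a + b) C a)
  subset-of-subset j a b = ℕ.*-cancelʳ-≡ _ _ (j ! * (a ! * b !)) {{ℕ.m*n≢0 _ _ {{ℕ._!≢0 j}} {{ℕ._!*_!≢0 a b}}}}
    (≡.trans lhs (≡.sym rhs))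
    where
    open +-*-Solver
    lhs : ((j + a + b) C (j + a)) * ((j + a) C j) * (j ! * (a ! * b !)) ≡ (j + a + b) !
    lhs = begin
      ((j + a + b) C (j + a)) * ((j + a) C j) * (j ! * (a ! * b !))
        ≡⟨ solve 5 (λ x y z u v → x :* y :* (z :* (u :* v)) := x :* ((y :* (z :* u)) :* v)) ≡.refl ((j + a + b) C (j + a)) ((j + a) C j) (j !) (a !) (b !) ⟩
      ((j + a + b) C (j + a)) * (((j + a) C j) * (j ! * a !) * b !)
        ≡⟨ ≡.cong (λ t → ((j + a + b) C (j + a)) * (t * b !)) ([m+n]Cm*m!*n!≡[m+n]! j a) ⟩
      ((j + a + b) C (j + a)) * ((j + a) ! * b !)
        ≡⟨ [m+n]Cm*m!*n!≡[m+n]! (j + a) b ⟩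
      (j + a + b) ! ∎
      where open ≡.≡-Reasoning
    rhs : ((j + a + b) C j) * ((a + b) C a) * (j ! * (a ! * b !)) ≡ (j + a + b) !
    rhs = begin
      ((j + a + b) C j) * ((a + b) C a) * (j ! * (a ! * b !))
        ≡⟨ solve 5 (λ x y z u v → x :* y :* (z :* (u :* v)) := x :* (z :* (y :* (u :* v)))) ≡.refl ((j + a + b) C j) (((a + b) C a)) (j !) (a !) (b !) ⟩
      ((j + a + b) C j) * (j ! * (((a + b) C a) * (a ! * b !)))
        ≡⟨ ≡.cong (λ t → ((j + a + b) C j) * (j ! * t)) ([m+n]Cm*m!*n!≡[m+n]! a b) ⟩
      ((j + a + b) C j) * (j ! * (a + b) !)
        ≡⟨ ≡.subst (λ t → (t C j) * (j ! * (a + b) !) ≡ t !) (≡.sym (ℕ.+-assoc j a b)) ([m+n]Cm*m!*n!≡[m+n]! j (a + b)) ⟩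
      (j + a + b) ! ∎
      where open ≡.≡-Reasoning

  +-∸-interchange : ∀ {m n o p} → o ≤ m → p ≤ n → (m + n) ∸ (o + p) ≡ (m ∸ o) + (n ∸ p)
  +-∸-interchange {m} {n} {o} {p} o≤m p≤n = begin
    (m + n) ∸ (o + p)   ≡⟨ ℕ.∸-+-assoc (m + n) o p ⟨
    (m + n) ∸ o ∸ p     ≡⟨ ≡.cong (_∸ p) (ℕ.+-∸-comm n o≤m) ⟩
    (m ∸ o) + n ∸ p     ≡⟨ ℕ.+-∸-assoc (m ∸ o) p≤n ⟩
    (m ∸ o) + (n ∸ p)   ∎
    where open ≡.≡-Reasoning

open Arithmetic using (subset-of-subset; +-∸-interchange)

module Sums {a ℓ} (S : Semiring a ℓ) where
  open Semiring S
  open SetoidReasoning setoid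
  open import Algebra.Properties.CommutativeSemigroup +-commutativeSemigroup using () renaming (interchange to +-interchange)

  private variable
    b : Level
    A B : Set b

  ∑ : List A → (A → Carrier) → Carrier
  ∑ []       f = 0#
  ∑ (x ∷ xs) f = f x + ∑ xs f

  syntax ∑ xs (λ x → e) = ∑[ x ← xs ] e

  ∑-cong : ∀ (xs : List A) {f g : A → Carrier} → (∀ x → f x ≈ g x) → ∑ xs f ≈ ∑ xs g
  ∑-cong []       f≈g = refl
  ∑-cong (x ∷ xs) f≈g = +-cong (f≈g x) (∑-cong xs f≈g)

  ∑-congᴬ : ∀ {P : A → Set b} {xs} {f g : A → Carrier} → All P xs → (∀ {x} → P x → f x ≈ g x) → ∑ xs f ≈ ∑ xs g
  ∑-congᴬ []         f≈g = refl
  ∑-congᴬ (px ∷ pxs) f≈g = +-cong (f≈g px) (∑-congᴬ pxs f≈g)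

  ∑-0 : ∀ (xs : List A) {f : A → Carrier} → (∀ x → f x ≈ 0#) → ∑ xs f ≈ 0#
  ∑-0 []       f≈0 = refl
  ∑-0 (x ∷ xs) f≈0 = trans (+-cong (f≈0 x) (∑-0 xs f≈0)) (+-identityʳ 0#)

  ∑-++ : ∀ (xs ys : List A) f → ∑ (xs ++ ys) f ≈ ∑ xs f + ∑ ys f
  ∑-++ []       ys f = sym (+-identityˡ _)
  ∑-++ (x ∷ xs) ys f = trans (+-congˡ (∑-++ xs ys f)) (sym (+-assoc _ _ _))

  ∑-map : ∀ (h : A → B) xs f → ∑ (map h xs) f ≡ ∑[ x ← xs ] f (h x)
  ∑-map h []       f = ≡.refl
  ∑-map h (x ∷ xs) f = ≡.cong (f (h x) +_) (∑-map h xs f)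

  ∑-concatMap : ∀ (h : A → List B) xs f → ∑ (concatMap h xs) f ≈ ∑[ x ← xs ] ∑ (h x) f
  ∑-concatMap h []       f = refl
  ∑-concatMap h (x ∷ xs) f = trans (∑-++ (h x) (concatMap h xs) f) (+-congˡ (∑-concatMap h xs f))

  ∑-filterᵇ : ∀ (p : A → Bool) xs f → ∑ (filterᵇ p xs) f ≈ ∑[ x ← xs ] (if p x then f x else 0#)
  ∑-filterᵇ p []       f = refl
  ∑-filterᵇ p (x ∷ xs) f with p x
  ... | true  = +-congˡ (∑-filterᵇ p xs f)
  ... | false = trans (∑-filterᵇ p xs f) (sym (+-identityˡ _))

  ∑-distrib-+ : ∀ (xs : List A) f g → ∑[ x ← xs ] (f x + g x) ≈ ∑ xs f + ∑ xs g
  ∑-distrib-+ []       f g = sym (+-identityʳ 0#)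
  ∑-distrib-+ (x ∷ xs) f g = trans (+-congˡ (∑-distrib-+ xs f g)) (+-interchange _ _ _ _)

  *-distribˡ-∑ : ∀ (xs : List A) c f → ∑[ x ← xs ] (c * f x) ≈ c * ∑ xs f
  *-distribˡ-∑ []       c f = sym (zeroʳ c)
  *-distribˡ-∑ (x ∷ xs) c f = trans (+-congˡ (*-distribˡ-∑ xs c f)) (sym (distribˡ c _ _))

  ∑-comm : ∀ (xs : List A) (ys : List B) (f : A → B → Carrier) → ∑[ x ← xs ] ∑[ y ← ys ] f x y ≈ ∑[ y ← ys ] ∑[ x ← xs ] f x y
  ∑-comm []       ys f = sym (∑-0 ys (λ _ → refl))
  ∑-comm (x ∷ xs) ys f = trans (+-congˡ (∑-comm xs ys f)) (sym (∑-distrib-+ ys (f x) _))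

  ∑-∷ʳ : ∀ (xs : List A) x f → ∑ (xs ∷ʳ x) f ≈ ∑ xs f + f x
  ∑-∷ʳ xs x f = trans (∑-++ xs (x ∷ []) f) (+-congˡ (+-identityʳ (f x)))

  ∑₂ : ℕ → (ℕ → ℕ → Carrier) → Carrier
  ∑₂ zero    f = f 0 0
  ∑₂ (suc p) f = f 0 (suc p) + ∑₂ p (λ a b → f (suc a) b)

  syntax ∑₂ p (λ a b → e) = ∑[ a + b ≡ p ] e

  ∑₂-congᴱ : ∀ p {f g : ℕ → ℕ → Carrier} → (∀ a b → a ℕ.+ b ≡ p → f a b ≈ g a b) → ∑₂ p f ≈ ∑₂ p g
  ∑₂-congᴱ zero    f≈g = f≈g 0 0 ≡.refl
  ∑₂-congᴱ (suc p) f≈g = +-cong (f≈g 0 (suc p) ≡.refl) (∑₂-congᴱ p (λ a b eq → f≈g (suc a) b (≡.cong suc eq)))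

  ∑₂-cong : ∀ p {f g : ℕ → ℕ → Carrier} → (∀ a b → f a b ≈ g a b) → ∑₂ p f ≈ ∑₂ p g
  ∑₂-cong p f≈g = ∑₂-congᴱ p (λ a b _ → f≈g a b)

  ∑₂≈∑-upTo : ∀ p (f : ℕ → ℕ → Carrier) → ∑₂ p f ≈ ∑[ a ← upTo (suc p) ] f a (p ℕ.∸ a)
  ∑₂≈∑-upTo zero    f = sym (+-identityʳ _)
  ∑₂≈∑-upTo (suc p) f = +-congˡ (begin
    ∑₂ p (λ a b → f (suc a) b)                          ≈⟨ ∑₂≈∑-upTo p (λ a b → f (suc a) b) ⟩
    ∑[ a ← upTo (suc p) ] f (suc a) (p ℕ.∸ a)           ≡⟨ ∑-map suc (upTo (suc p)) (λ a → f a (suc p ℕ.∸ a)) ⟨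
    ∑[ a ← map suc (upTo (suc p)) ] f a (suc p ℕ.∸ a)   ≡⟨ ≡.cong (λ as → ∑[ a ← as ] f a (suc p ℕ.∸ a)) (map-upTo suc (suc p)) ⟩
    ∑[ a ← applyUpTo suc (suc p) ] f a (suc p ℕ.∸ a)    ∎)

  ∑₂-0 : ∀ p {f : ℕ → ℕ → Carrier} → (∀ a b → f a b ≈ 0#) → ∑₂ p f ≈ 0#
  ∑₂-0 zero    f≈0 = f≈0 0 0
  ∑₂-0 (suc p) f≈0 = trans (+-cong (f≈0 0 (suc p)) (∑₂-0 p (λ a → f≈0 (suc a)))) (+-identityʳ 0#)

  ∑₂-distrib-+ : ∀ p (f g : ℕ → ℕ → Carrier) → ∑[ a + b ≡ p ] (f a b + g a b) ≈ ∑₂ p f + ∑₂ p g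
  ∑₂-distrib-+ zero    f g = refl
  ∑₂-distrib-+ (suc p) f g = trans (+-congˡ (∑₂-distrib-+ p _ _)) (+-interchange _ _ _ _)

  *-distribˡ-∑₂ : ∀ p c (f : ℕ → ℕ → Carrier) → ∑[ a + b ≡ p ] (c * f a b) ≈ c * ∑₂ p f
  *-distribˡ-∑₂ zero    c f = refl
  *-distribˡ-∑₂ (suc p) c f = trans (+-congˡ (*-distribˡ-∑₂ p c _)) (sym (distribˡ c _ _))

  ∑₂-splitLast : ∀ p (f : ℕ → ℕ → Carrier) → ∑₂ (suc p) f ≈ ∑[ a + b ≡ p ] f a (suc b) + f (suc p) 0
  ∑₂-splitLast zero    f = refl
  ∑₂-splitLast (suc p) f = begin
    f 0 (suc (suc p)) + ∑₂ (suc p) (λ a b → f (suc a) b)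
      ≈⟨ +-congˡ (∑₂-splitLast p (λ a b → f (suc a) b)) ⟩
    f 0 (suc (suc p)) + (∑[ a + b ≡ p ] f (suc a) (suc b) + f (suc (suc p)) 0)
      ≈⟨ sym (+-assoc _ _ _) ⟩
    f 0 (suc (suc p)) + ∑[ a + b ≡ p ] f (suc a) (suc b) + f (suc (suc p)) 0 ∎

  ∑₂-last : ∀ p {f : ℕ → ℕ → Carrier} → (∀ a b → f a (suc b) ≈ 0#) → ∑₂ p f ≈ f p 0
  ∑₂-last zero    f≈0 = refl
  ∑₂-last (suc p) {f} f≈0 = begin
    ∑₂ (suc p) f                             ≈⟨ ∑₂-splitLast p f ⟩
    ∑[ a + b ≡ p ] f a (suc b) + f (suc p) 0 ≈⟨ +-congʳ (∑₂-0 p f≈0) ⟩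
    0# + f (suc p) 0                         ≈⟨ +-identityˡ _ ⟩
    f (suc p) 0                              ∎

  ∑₂-assoc : ∀ p (f : ℕ → ℕ → ℕ → Carrier) →
    ∑[ l + s ≡ p ] ∑[ a + b ≡ s ] f l a b ≈ ∑[ s + b ≡ p ] ∑[ l + a ≡ s ] f l a b
  ∑₂-assoc zero    f = refl
  ∑₂-assoc (suc p) f = begin
    (f 0 0 (suc p) + ∑[ a + b ≡ p ] f 0 (suc a) b) + ∑[ l + s ≡ p ] ∑[ a + b ≡ s ] f (suc l) a b
      ≈⟨ +-congˡ (∑₂-assoc p (λ l → f (suc l))) ⟩
    (f 0 0 (suc p) + ∑[ a + b ≡ p ] f 0 (suc a) b) + ∑[ s + b ≡ p ] ∑[ l + a ≡ s ] f (suc l) a b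
      ≈⟨ +-assoc _ _ _ ⟩
    f 0 0 (suc p) + (∑[ a + b ≡ p ] f 0 (suc a) b + ∑[ s + b ≡ p ] ∑[ l + a ≡ s ] f (suc l) a b)
      ≈⟨ +-congˡ (sym (∑₂-distrib-+ p _ _)) ⟩
    f 0 0 (suc p) + ∑[ s + b ≡ p ] (f 0 (suc s) b + ∑[ l + a ≡ s ] f (suc l) a b) ∎

  ∑-range-suc : ∀ lo n (f : ℕ → Carrier) → ∑ (map (lo ℕ.+_) (upTo (suc n))) f ≈ ∑ (map (lo ℕ.+_) (upTo n)) f + f (lo ℕ.+ n)
  ∑-range-suc lo n f = begin
    ∑ (map (lo ℕ.+_) (upTo (suc n))) f               ≡⟨ ≡.cong (λ ts → ∑ (map (lo ℕ.+_) ts) f) (upTo-∷ʳ n) ⟨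
    ∑ (map (lo ℕ.+_) (upTo n ∷ʳ n)) f                ≡⟨ ≡.cong (λ ts → ∑ ts f) (map-++ (lo ℕ.+_) (upTo n) (n ∷ [])) ⟩
    ∑ (map (lo ℕ.+_) (upTo n) ∷ʳ (lo ℕ.+ n)) f       ≈⟨ ∑-∷ʳ (map (lo ℕ.+_) (upTo n)) (lo ℕ.+ n) f ⟩
    ∑ (map (lo ℕ.+_) (upTo n)) f + f (lo ℕ.+ n)      ∎

  module _ (x : ℕ) (g : ℕ → Carrier) where

    δ : ℕ → Carrier
    δ s = if x ≡ᵇ s then g s else 0#

    δ-≢ : ∀ {s} → x ≢ s → δ s ≈ 0#
    δ-≢ {s} x≢s with x ≡ᵇ s in eq
    ... | false = refl
    ... | true  = ⊥-elim (x≢s (ℕ.≡ᵇ⇒≡ x s (≡.subst T (≡.sym eq) tt)))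

    δ-refl : δ x ≈ g x
    δ-refl with x ≡ᵇ x | ℕ.≡⇒≡ᵇ x x ≡.refl
    ... | true | _ = refl

    ∑-range-δ-out : ∀ lo n → lo ℕ.+ n ≤ x → ∑ (map (lo ℕ.+_) (upTo n)) δ ≈ 0#
    ∑-range-δ-out lo zero    _          = refl
    ∑-range-δ-out lo (suc n) lo+1+n≤x = begin
      ∑ (map (lo ℕ.+_) (upTo (suc n))) δ         ≈⟨ ∑-range-suc lo n δ ⟩
      ∑ (map (lo ℕ.+_) (upTo n)) δ + δ (lo ℕ.+ n) ≈⟨ +-cong (∑-range-δ-out lo n (ℕ.<⇒≤ lo+n<x)) (δ-≢ (≡.≢-sym (ℕ.<⇒≢ lo+n<x))) ⟩
      0# + 0#                                     ≈⟨ +-identityʳ 0# ⟩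
      0#                                          ∎
      where
      lo+n<x : lo ℕ.+ n < x
      lo+n<x = ≡.subst (_≤ x) (ℕ.+-suc lo n) lo+1+n≤x

    ∑-range-δ-in : ∀ lo n → lo ≤ x → x < lo ℕ.+ n → ∑ (map (lo ℕ.+_) (upTo n)) δ ≈ g x
    ∑-range-δ-in lo zero    lo≤x x<lo+0 = ⊥-elim (ℕ.<⇒≱ x<lo+0 (ℕ.≤-trans (ℕ.≤-reflexive (ℕ.+-identityʳ lo)) lo≤x))
    ∑-range-δ-in lo (suc n) lo≤x x<lo+1+n with ℕ.m<1+n⇒m<n∨m≡n (≡.subst (x <_) (ℕ.+-suc lo n) x<lo+1+n)
    ... | inj₁ x<lo+n = begin
      ∑ (map (lo ℕ.+_) (upTo (suc n))) δ          ≈⟨ ∑-range-suc lo n δ ⟩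
      ∑ (map (lo ℕ.+_) (upTo n)) δ + δ (lo ℕ.+ n) ≈⟨ +-cong (∑-range-δ-in lo n lo≤x x<lo+n) (δ-≢ (ℕ.<⇒≢ x<lo+n)) ⟩
      g x + 0#                                    ≈⟨ +-identityʳ _ ⟩
      g x                                         ∎
    ... | inj₂ x≡lo+n = begin
      ∑ (map (lo ℕ.+_) (upTo (suc n))) δ          ≈⟨ ∑-range-suc lo n δ ⟩
      ∑ (map (lo ℕ.+_) (upTo n)) δ + δ (lo ℕ.+ n) ≈⟨ +-cong (∑-range-δ-out lo n (ℕ.≤-reflexive (≡.sym x≡lo+n))) (≡.subst (λ y → δ y ≈ g x) x≡lo+n δ-refl) ⟩
      0# + g x                                    ≈⟨ +-identityˡ _ ⟩
      g x                                         ∎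

module TupleWeights {c ℓ} (K : CommutativeRing c ℓ) where
  open Comodule K using (tuples; weight; binomProd)
  open ≡.≡-Reasoning

  binomProd-self : ∀ w → binomProd w w ≡ 1
  binomProd-self []       = ≡.refl
  binomProd-self (p ∷ ps) = ≡.cong₂ ℕ._*_ (nCn≡1 (suc p)) (binomProd-self ps)

  length≤weight : ∀ w → length w ≤ weight w
  length≤weight []       = z≤n
  length≤weight (p ∷ ps) = s≤s (ℕ.≤-trans (length≤weight ps) (ℕ.m≤n+m _ p))

  WeightIn : ℕ → ℕ → Word → Set
  WeightIn lo hi k = lo ≤ weight k × weight k < hi

  tuples-weightIn : ∀ w → All (WeightIn (length w) (suc (weight w))) (tuples w)
  tuples-weightIn []       = (z≤n , s≤s z≤n) ∷ []
  tuples-weightIn (p ∷ ps) =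
    All.concat⁺ (All.map⁺ (All.applyUpTo⁺₁ (λ j → j) (suc p) (λ { (s≤s j≤p) →
      All.map⁺ (All.map (λ { (lo≤wk , s≤s wk≤W) → s≤s (ℕ.≤-trans lo≤wk (ℕ.m≤n+m _ _)) , s≤s (s≤s (ℕ.+-mono-≤ j≤p wk≤W)) })
                        (tuples-weightIn ps)) })))

  tuples-split : ∀ w → Σ[ I ∈ List Word ] (tuples w ≡ I ∷ʳ w) × All (WeightIn (length w) (weight w)) I
  tuples-split []       = [] , ≡.refl , []
  tuples-split (p ∷ ps) with tuples-split ps
  ... | I , tuples-ps≡I∷ʳps , I-light = concatMap F (upTo p) ++ map (p ∷_) I , tuples≡ , All.++⁺ lighter-first lighter-last
    where
    F : ℕ → List Word
    F j = map (j ∷_) (tuples ps)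
    tuples≡ : tuples (p ∷ ps) ≡ (concatMap F (upTo p) ++ map (p ∷_) I) ∷ʳ (p ∷ ps)
    tuples≡ = begin
      concatMap F (upTo (suc p))                              ≡⟨ ≡.cong (concatMap F) (upTo-∷ʳ p) ⟨
      concatMap F (upTo p ∷ʳ p)                               ≡⟨ concatMap-++ F (upTo p) (p ∷ []) ⟩
      concatMap F (upTo p) ++ (F p ++ [])                     ≡⟨ ≡.cong (concatMap F (upTo p) ++_) (++-identityʳ (F p)) ⟩
      concatMap F (upTo p) ++ map (p ∷_) (tuples ps)          ≡⟨ ≡.cong (λ ks → concatMap F (upTo p) ++ map (p ∷_) ks) tuples-ps≡I∷ʳps ⟩
      concatMap F (upTo p) ++ map (p ∷_) (I ∷ʳ ps)            ≡⟨ ≡.cong (concatMap F (upTo p) ++_) (map-++ (p ∷_) I (ps ∷ [])) ⟩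
      concatMap F (upTo p) ++ (map (p ∷_) I ∷ʳ (p ∷ ps))      ≡⟨ ++-assoc (concatMap F (upTo p)) (map (p ∷_) I) _ ⟨
      (concatMap F (upTo p) ++ map (p ∷_) I) ∷ʳ (p ∷ ps)      ∎
    lighter-first : All (WeightIn (length (p ∷ ps)) (weight (p ∷ ps))) (concatMap F (upTo p))
    lighter-first = All.concat⁺ (All.map⁺ (All.applyUpTo⁺₁ (λ j → j) p (λ j<p →
      All.map⁺ (All.map (λ { (lo≤wk , s≤s wk≤W) → s≤s (ℕ.≤-trans lo≤wk (ℕ.m≤n+m _ _)) , s≤s (ℕ.+-mono-<-≤ j<p wk≤W) })
                        (tuples-weightIn ps)))))
    lighter-last : All (WeightIn (length (p ∷ ps)) (weight (p ∷ ps))) (map (p ∷_) I)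
    lighter-last = All.map⁺ (All.map (λ { (lo≤wk , wk<W) → s≤s (ℕ.≤-trans lo≤wk (ℕ.m≤n+m _ _)) , s≤s (ℕ.+-monoʳ-< p wk<W) }) I-light)

module _ {c ℓ} (K : CommutativeRing c ℓ) where
  open CommutativeRing K
  open Comodule K
  open Sums semiring
  open SetoidReasoning setoid
  open TupleWeights K
  open import Algebra.Properties.CommutativeSemigroup +-commutativeSemigroup using () renaming (x∙yz≈y∙xz to +-leftSwap)
  open import Algebra.Properties.CommutativeSemigroup *-commutativeSemigroup using () renaming (x∙yz≈y∙xz to *-leftSwap)
  open import Algebra.Properties.Semiring.Mult semiring using (×-homo-+; ×1-homo-*) renaming (_×_ to _·_)

  choose : ℕ → ℕ → Carrier
  choose n k = ℕ→R K (n C k)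

  ℕ→R≡·1# : ∀ n → ℕ→R K n ≡ n · 1#
  ℕ→R≡·1# zero    = ≡.refl
  ℕ→R≡·1# (suc n) = ≡.cong (1# +_) (ℕ→R≡·1# n)

  ℕ→R-homo-* : ∀ m n → ℕ→R K (m ℕ.* n) ≈ ℕ→R K m * ℕ→R K n
  ℕ→R-homo-* m n = begin
    ℕ→R K (m ℕ.* n)         ≡⟨ ℕ→R≡·1# (m ℕ.* n) ⟩
    (m ℕ.* n) · 1#          ≈⟨ ×1-homo-* m n ⟩
    (m · 1#) * (n · 1#)     ≡⟨ ≡.cong₂ _*_ (ℕ→R≡·1# m) (ℕ→R≡·1# n) ⟨
    ℕ→R K m * ℕ→R K n       ∎

  ℕ→R-homo-+ : ∀ m n → ℕ→R K (m ℕ.+ n) ≈ ℕ→R K m + ℕ→R K n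
  ℕ→R-homo-+ m n = begin
    ℕ→R K (m ℕ.+ n)         ≡⟨ ℕ→R≡·1# (m ℕ.+ n) ⟩
    (m ℕ.+ n) · 1#          ≈⟨ ×-homo-+ 1# m n ⟩
    m · 1# + n · 1#         ≡⟨ ≡.cong₂ _+_ (ℕ→R≡·1# m) (ℕ→R≡·1# n) ⟨
    ℕ→R K m + ℕ→R K n       ∎

  ℕ→R-1 : ℕ→R K 1 ≈ 1#
  ℕ→R-1 = +-identityʳ 1#

  choose-n-n : ∀ n → choose n n ≈ 1#
  choose-n-n n = trans (reflexive (≡.cong (ℕ→R K) (nCn≡1 n))) ℕ→R-1

  ⟨_∣_⟩ : {B : Set} → FS B → (B → Carrier) → Carrier
  ⟨ X ∣ φ ⟩ = ∑[ e ← X ] (proj₁ e * φ (proj₂ e))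

  ⟨∣⟩-cong : ∀ {B : Set} (X : FS B) {φ ψ : B → Carrier} → (∀ b → φ b ≈ ψ b) → ⟨ X ∣ φ ⟩ ≈ ⟨ X ∣ ψ ⟩
  ⟨∣⟩-cong X φ≈ψ = ∑-cong X (λ e → *-congˡ (φ≈ψ (proj₂ e)))

  ⟨linExt∣⟩ : ∀ {A B : Set} (f : A → FS B) (X : FS A) (φ : B → Carrier) → ⟨ linExt f X ∣ φ ⟩ ≈ ⟨ X ∣ (λ x → ⟨ f x ∣ φ ⟩) ⟩
  ⟨linExt∣⟩ f []             φ = refl
  ⟨linExt∣⟩ f ((a , x) ∷ xs) φ = begin
    ⟨ map _ (f x) ++ linExt f xs ∣ φ ⟩                  ≈⟨ ∑-++ (map _ (f x)) (linExt f xs) _ ⟩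
    ⟨ map _ (f x) ∣ φ ⟩ + ⟨ linExt f xs ∣ φ ⟩           ≡⟨ ≡.cong (_+ _) (∑-map _ (f x) _) ⟩
    ∑[ e ← f x ] (a * proj₁ e * φ (proj₂ e)) + _        ≈⟨ +-cong (∑-cong (f x) (λ e → *-assoc a _ _)) (⟨linExt∣⟩ f xs φ) ⟩
    ∑[ e ← f x ] (a * (proj₁ e * φ (proj₂ e))) + _      ≈⟨ +-congʳ (*-distribˡ-∑ (f x) a _) ⟩
    a * ⟨ f x ∣ φ ⟩ + ⟨ xs ∣ (λ y → ⟨ f y ∣ φ ⟩) ⟩       ∎

  dualBasis : {B : Set} → DecidableEquality B → B → B → Carrier
  dualBasis _≟_ b y with y ≟ b
  ... | yes _ = 1#
  ... | no  _ = 0#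

  coeff≈⟨∣dualBasis⟩ : ∀ {B : Set} (_≟_ : DecidableEquality B) (X : FS B) b → coeff _≟_ X b ≈ ⟨ X ∣ dualBasis _≟_ b ⟩
  coeff≈⟨∣dualBasis⟩ _≟_ []             b = refl
  coeff≈⟨∣dualBasis⟩ _≟_ ((a , y) ∷ xs) b with y ≟ b
  ... | yes _ = +-cong (sym (*-identityʳ a)) (coeff≈⟨∣dualBasis⟩ _≟_ xs b)
  ... | no  _ = trans (coeff≈⟨∣dualBasis⟩ _≟_ xs b) (sym (trans (+-congʳ (zeroʳ a)) (+-identityˡ _)))

  ⟨∣⟩⇒Eq : ∀ {B : Set} (_≟_ : DecidableEquality B) {X Y : FS B} → (∀ φ → ⟨ X ∣ φ ⟩ ≈ ⟨ Y ∣ φ ⟩) → Eq _≟_ X Y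
  ⟨∣⟩⇒Eq _≟_ {X} {Y} X≈Y b = begin
    coeff _≟_ X b                  ≈⟨ coeff≈⟨∣dualBasis⟩ _≟_ X b ⟩
    ⟨ X ∣ dualBasis _≟_ b ⟩        ≈⟨ X≈Y (dualBasis _≟_ b) ⟩
    ⟨ Y ∣ dualBasis _≟_ b ⟩        ≈⟨ coeff≈⟨∣dualBasis⟩ _≟_ Y b ⟨
    coeff _≟_ Y b                  ∎

  ⟨mulHH∣⟩ : ∀ (X Y : FS (ℕ × ℕ)) φ →
    ⟨ mulHH X Y ∣ φ ⟩ ≈ ⟨ X ∣ (λ ij → ⟨ Y ∣ (λ kl → φ (proj₁ ij ℕ.+ proj₁ kl , proj₂ ij ℕ.+ proj₂ kl)) ⟩) ⟩
  ⟨mulHH∣⟩ []                  Y φ = refl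
  ⟨mulHH∣⟩ ((a , (i , j)) ∷ xs) Y φ = begin
    ⟨ map _ Y ++ mulHH xs Y ∣ φ ⟩                 ≈⟨ ∑-++ (map _ Y) (mulHH xs Y) _ ⟩
    ⟨ map _ Y ∣ φ ⟩ + ⟨ mulHH xs Y ∣ φ ⟩          ≡⟨ ≡.cong (_+ _) (∑-map _ Y _) ⟩
    ∑[ e ← Y ] (a * proj₁ e * ψ (proj₂ e)) + _    ≈⟨ +-cong (∑-cong Y (λ e → *-assoc a _ _)) (⟨mulHH∣⟩ xs Y φ) ⟩
    ∑[ e ← Y ] (a * (proj₁ e * ψ (proj₂ e))) + _  ≈⟨ +-congʳ (*-distribˡ-∑ Y a _) ⟩
    a * ⟨ Y ∣ ψ ⟩ + _                             ∎
    where
    ψ : ℕ × ℕ → Carrier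
    ψ (k , l) = φ (i ℕ.+ k , j ℕ.+ l)

  ⟨ΔH-zero∣⟩ : ∀ φ → ⟨ ΔH 0 ∣ φ ⟩ ≈ φ (0 , 0)
  ⟨ΔH-zero∣⟩ φ = trans (+-identityʳ _) (*-identityˡ _)

  ⟨ΔH-suc∣⟩ : ∀ m φ → ⟨ ΔH (suc m) ∣ φ ⟩ ≈ ⟨ ΔH m ∣ (λ ab → φ (suc (proj₁ ab) , proj₂ ab)) ⟩ + ⟨ ΔH m ∣ (λ ab → φ (proj₁ ab , suc (proj₂ ab))) ⟩
  ⟨ΔH-suc∣⟩ m φ = trans (⟨mulHH∣⟩ Δ1 (ΔH m) φ) (+-cong (*-identityˡ _) (trans (+-identityʳ _) (*-identityˡ _)))

  ⟨ΔH-+∣⟩ : ∀ r m φ → ⟨ ΔH (r ℕ.+ m) ∣ φ ⟩ ≈ ⟨ ΔH r ∣ (λ ab → ⟨ ΔH m ∣ (λ ab′ → φ (proj₁ ab ℕ.+ proj₁ ab′ , proj₂ ab ℕ.+ proj₂ ab′)) ⟩) ⟩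
  ⟨ΔH-+∣⟩ zero    m φ = sym (⟨ΔH-zero∣⟩ (λ ab → ⟨ ΔH m ∣ (λ ab′ → φ (proj₁ ab ℕ.+ proj₁ ab′ , proj₂ ab ℕ.+ proj₂ ab′)) ⟩))
  ⟨ΔH-+∣⟩ (suc r) m φ = begin
    ⟨ ΔH (suc r ℕ.+ m) ∣ φ ⟩
      ≈⟨ ⟨ΔH-suc∣⟩ (r ℕ.+ m) φ ⟩
    ⟨ ΔH (r ℕ.+ m) ∣ (λ ab → φ (suc (proj₁ ab) , proj₂ ab)) ⟩ + ⟨ ΔH (r ℕ.+ m) ∣ (λ ab → φ (proj₁ ab , suc (proj₂ ab))) ⟩
      ≈⟨ +-cong (⟨ΔH-+∣⟩ r m _) (⟨ΔH-+∣⟩ r m _) ⟩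
    _ ≈⟨ ⟨ΔH-suc∣⟩ r _ ⟨
    ⟨ ΔH (suc r) ∣ (λ ab → ⟨ ΔH m ∣ (λ ab′ → φ (proj₁ ab ℕ.+ proj₁ ab′ , proj₂ ab ℕ.+ proj₂ ab′)) ⟩) ⟩ ∎

  ⟨ΔH∣⟩-binomial : ∀ m φ → ⟨ ΔH m ∣ φ ⟩ ≈ ∑[ a + b ≡ m ] (choose m a * φ (a , b))
  ⟨ΔH∣⟩-binomial zero    φ = trans (⟨ΔH-zero∣⟩ φ) (sym (trans (*-congʳ ℕ→R-1) (*-identityˡ _)))
  ⟨ΔH∣⟩-binomial (suc m) φ = begin
    ⟨ ΔH (suc m) ∣ φ ⟩
      ≈⟨ ⟨ΔH-suc∣⟩ m φ ⟩
    ⟨ ΔH m ∣ (λ ab → φ (suc (proj₁ ab) , proj₂ ab)) ⟩ + ⟨ ΔH m ∣ (λ ab → φ (proj₁ ab , suc (proj₂ ab))) ⟩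
      ≈⟨ +-cong (⟨ΔH∣⟩-binomial m _) (⟨ΔH∣⟩-binomial m _) ⟩
    ∑[ a + b ≡ m ] (choose m a * φ (suc a , b)) + ∑[ a + b ≡ m ] f a (suc b)
      ≈⟨ +-congˡ (peel-first≈peel-last) ⟩
    ∑[ a + b ≡ m ] (choose m a * φ (suc a , b)) + (f 0 (suc m) + ∑[ a + b ≡ m ] f (suc a) b)
      ≈⟨ +-leftSwap _ _ _ ⟩
    f 0 (suc m) + (∑[ a + b ≡ m ] (choose m a * φ (suc a , b)) + ∑[ a + b ≡ m ] f (suc a) b)
      ≈⟨ +-congˡ (sym (∑₂-distrib-+ m _ _)) ⟩
    f 0 (suc m) + ∑[ a + b ≡ m ] (choose m a * φ (suc a , b) + choose m (suc a) * φ (suc a , b))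
      ≈⟨ +-congˡ (∑₂-cong m (λ a b → pascal a (φ (suc a , b)))) ⟩
    ∑[ a + b ≡ suc m ] (choose (suc m) a * φ (a , b)) ∎
    where
    f : ℕ → ℕ → Carrier
    f a b = choose m a * φ (a , b)
    peel-first≈peel-last : ∑[ a + b ≡ m ] f a (suc b) ≈ f 0 (suc m) + ∑[ a + b ≡ m ] f (suc a) b
    peel-first≈peel-last = begin
      ∑[ a + b ≡ m ] f a (suc b)                  ≈⟨ +-identityʳ _ ⟨
      ∑[ a + b ≡ m ] f a (suc b) + 0#             ≈⟨ +-congˡ (trans (*-congʳ (reflexive (≡.cong (ℕ→R K) (k>n⇒nCk≡0 (ℕ.n<1+n m))))) (zeroˡ _)) ⟨
      ∑[ a + b ≡ m ] f a (suc b) + f (suc m) 0    ≈⟨ ∑₂-splitLast m f ⟨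
      ∑₂ (suc m) f                                ∎
    pascal : ∀ a x → choose m a * x + choose m (suc a) * x ≈ choose (suc m) (suc a) * x
    pascal a x = begin
      choose m a * x + choose m (suc a) * x       ≈⟨ distribʳ x _ _ ⟨
      (choose m a + choose m (suc a)) * x         ≈⟨ *-congʳ (ℕ→R-homo-+ (m C a) (m C suc a)) ⟨
      ℕ→R K (m C a ℕ.+ m C suc a) * x             ≡⟨ ≡.cong (λ n → ℕ→R K n * x) (nCk+nC[k+1]≡[n+1]C[k+1] m a) ⟩
      choose (suc m) (suc a) * x                  ∎

  shift : ℕ → ℕ → (C⊗H-basis → Carrier) → C⊗H-basis → Carrier
  shift j r φ (k , m) = φ (j ∷ k , r ℕ.+ m)

  -- ⟨ ρ(w) ∣ φ ⟩ computed letter by letter; the letter (0,p+1) contributes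
  -- ∑_{j+r=p} C(p+1,j+1) (0,j+1) ⊗ (r).
  ρ* : Word → (C⊗H-basis → Carrier) → Carrier
  ρ* []       φ = φ ([] , 0)
  ρ* (p ∷ ps) φ = ∑[ j + r ≡ p ] (choose (suc p) (suc j) * ρ* ps (shift j r φ))

  ρ*-cong : ∀ w {φ ψ} → (∀ x → φ x ≈ ψ x) → ρ* w φ ≈ ρ* w ψ
  ρ*-cong []       φ≈ψ = φ≈ψ _
  ρ*-cong (p ∷ ps) φ≈ψ = ∑₂-cong p (λ j r → *-congˡ (ρ*-cong ps (λ _ → φ≈ψ _)))

  ρ*-0 : ∀ w {φ} → (∀ x → φ x ≈ 0#) → ρ* w φ ≈ 0#
  ρ*-0 []       φ≈0 = φ≈0 _
  ρ*-0 (p ∷ ps) φ≈0 = ∑₂-0 p (λ j r → trans (*-congˡ (ρ*-0 ps (λ _ → φ≈0 _))) (zeroʳ _))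

  ρ*-+ : ∀ w φ ψ → ρ* w (λ x → φ x + ψ x) ≈ ρ* w φ + ρ* w ψ
  ρ*-+ []       φ ψ = refl
  ρ*-+ (p ∷ ps) φ ψ = trans
    (∑₂-cong p (λ j r → trans (*-congˡ (ρ*-+ ps (shift j r φ) (shift j r ψ))) (distribˡ _ _ _)))
    (∑₂-distrib-+ p _ _)

  ρ*-* : ∀ w a φ → ρ* w (λ x → a * φ x) ≈ a * ρ* w φ
  ρ*-* []       a φ = refl
  ρ*-* (p ∷ ps) a φ = trans
    (∑₂-cong p (λ j r → trans (*-congˡ (ρ*-* ps a (shift j r φ))) (*-leftSwap _ a _)))
    (*-distribˡ-∑₂ p a _)

  ρ*-∑₂ : ∀ w n (F : ℕ → ℕ → C⊗H-basis → Carrier) → ρ* w (λ x → ∑[ a + b ≡ n ] F a b x) ≈ ∑[ a + b ≡ n ] ρ* w (F a b)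
  ρ*-∑₂ w zero    F = refl
  ρ*-∑₂ w (suc n) F = trans (ρ*-+ w _ _) (+-congˡ (ρ*-∑₂ w n (λ a → F (suc a))))

  ρ*-⟨∣⟩ : ∀ w {B : Set} (X : FS B) (F : B → C⊗H-basis → Carrier) → ρ* w (λ x → ⟨ X ∣ (λ y → F y x) ⟩) ≈ ⟨ X ∣ (λ y → ρ* w (F y)) ⟩
  ρ*-⟨∣⟩ w []             F = ρ*-0 w (λ _ → refl)
  ρ*-⟨∣⟩ w ((a , y) ∷ xs) F = trans (ρ*-+ w _ _) (+-cong (ρ*-* w a (F y)) (ρ*-⟨∣⟩ w xs F))

  choose-coassoc : ∀ p (G : ℕ → ℕ → ℕ → Carrier) →
    ∑[ j + r ≡ p ] (choose (suc p) (suc j) * ∑[ l + a ≡ j ] (choose (suc j) (suc l) * G l a r))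
    ≈ ∑[ l + s ≡ p ] (choose (suc p) (suc l) * ∑[ a + b ≡ s ] (choose s a * G l a b))
  choose-coassoc p G = begin
    ∑[ j + r ≡ p ] (choose (suc p) (suc j) * ∑[ l + a ≡ j ] (choose (suc j) (suc l) * G l a r))
      ≈⟨ ∑₂-congᴱ p (λ j r j+r≡p → trans (sym (*-distribˡ-∑₂ j _ _))
           (∑₂-congᴱ j (λ l a l+a≡j → outer-coefficient l a r j+r≡p l+a≡j))) ⟩
    ∑[ j + r ≡ p ] ∑[ l + a ≡ j ] (c₁ l a r * G l a r)
      ≈⟨ ∑₂-assoc p (λ l a b → c₁ l a b * G l a b) ⟨
    ∑[ l + s ≡ p ] ∑[ a + b ≡ s ] (c₁ l a b * G l a b)
      ≈⟨ ∑₂-cong p (λ l s → ∑₂-cong s (λ a b → *-congʳ (reflexive (≡.cong (ℕ→R K) (subset-of-subset (suc l) a b))))) ⟩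
    ∑[ l + s ≡ p ] ∑[ a + b ≡ s ] (c₂ l a b * G l a b)
      ≈⟨ ∑₂-congᴱ p (λ l s l+s≡p → trans (∑₂-congᴱ s (λ a b a+b≡s → inner-coefficient l a b a+b≡s l+s≡p))
           (*-distribˡ-∑₂ s _ _)) ⟩
    ∑[ l + s ≡ p ] (choose (suc p) (suc l) * ∑[ a + b ≡ s ] (choose s a * G l a b)) ∎
    where
    c₁ c₂ : ℕ → ℕ → ℕ → Carrier
    c₁ l a b = ℕ→R K (((suc l ℕ.+ a ℕ.+ b) C (suc l ℕ.+ a)) ℕ.* ((suc l ℕ.+ a) C suc l))
    c₂ l a b = ℕ→R K (((suc l ℕ.+ a ℕ.+ b) C suc l) ℕ.* ((a ℕ.+ b) C a))
    outer-coefficient : ∀ {p j} l a r {x} → j ℕ.+ r ≡ p → l ℕ.+ a ≡ j →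
      choose (suc p) (suc j) * (choose (suc j) (suc l) * x) ≈ c₁ l a r * x
    outer-coefficient l a r ≡.refl ≡.refl = trans (sym (*-assoc _ _ _)) (*-congʳ (sym (ℕ→R-homo-* (suc (l ℕ.+ a ℕ.+ r) C suc (l ℕ.+ a)) (suc (l ℕ.+ a) C suc l))))
    inner-coefficient : ∀ {p s} l a b {x} → a ℕ.+ b ≡ s → l ℕ.+ s ≡ p →
      c₂ l a b * x ≈ choose (suc p) (suc l) * (choose s a * x)
    inner-coefficient l a b ≡.refl ≡.refl = trans
      (*-congʳ (trans (reflexive (≡.cong (λ n → ℕ→R K ((suc n C suc l) ℕ.* ((a ℕ.+ b) C a))) (ℕ.+-assoc l a b)))
                      (ℕ→R-homo-* (suc (l ℕ.+ (a ℕ.+ b)) C suc l) ((a ℕ.+ b) C a))))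
      (*-assoc _ _ _)

  ρ*-coassoc : ∀ w (ψ : Word → ℕ → ℕ → Carrier) →
    ρ* w (λ km → ρ* (proj₁ km) (λ li → ψ (proj₁ li) (proj₂ li) (proj₂ km)))
    ≈ ρ* w (λ km → ⟨ ΔH (proj₂ km) ∣ (λ ij → ψ (proj₁ km) (proj₁ ij) (proj₂ ij)) ⟩)
  ρ*-coassoc []       ψ = sym (⟨ΔH-zero∣⟩ (λ ij → ψ [] (proj₁ ij) (proj₂ ij)))
  ρ*-coassoc (p ∷ ps) ψ = begin
    ∑[ j + r ≡ p ] (choose (suc p) (suc j) * ρ* ps (λ km → ∑[ l + a ≡ j ] (choose (suc j) (suc l) * H r l a km)))
      ≈⟨ ∑₂-cong p (λ j r → *-congˡ (first-letters j r)) ⟩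
    ∑[ j + r ≡ p ] (choose (suc p) (suc j) * ∑[ l + a ≡ j ] (choose (suc j) (suc l) * G l a r))
      ≈⟨ choose-coassoc p G ⟩
    ∑[ l + s ≡ p ] (choose (suc p) (suc l) * ∑[ a + b ≡ s ] (choose s a * G l a b))
      ≈⟨ ∑₂-cong p (λ l s → *-congˡ (first-letter-Δ l s)) ⟩
    ∑[ l + s ≡ p ] (choose (suc p) (suc l) * ρ* ps (λ km → ⟨ ΔH (s ℕ.+ proj₂ km) ∣ (λ ij → ψ (l ∷ proj₁ km) (proj₁ ij) (proj₂ ij)) ⟩)) ∎
    where
    H : ℕ → ℕ → ℕ → C⊗H-basis → Carrier
    H r l a km = ρ* (proj₁ km) (λ li → ψ (l ∷ proj₁ li) (a ℕ.+ proj₂ li) (r ℕ.+ proj₂ km))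
    G : ℕ → ℕ → ℕ → Carrier
    G l a b = ρ* ps (λ km → ⟨ ΔH (proj₂ km) ∣ (λ ij → ψ (l ∷ proj₁ km) (a ℕ.+ proj₁ ij) (b ℕ.+ proj₂ ij)) ⟩)
    first-letters : ∀ j r → ρ* ps (λ km → ∑[ l + a ≡ j ] (choose (suc j) (suc l) * H r l a km))
                            ≈ ∑[ l + a ≡ j ] (choose (suc j) (suc l) * G l a r)
    first-letters j r = trans (ρ*-∑₂ ps j _) (∑₂-cong j (λ l a → trans (ρ*-* ps _ (H r l a))
      (*-congˡ (ρ*-coassoc ps (λ l′ i m → ψ (l ∷ l′) (a ℕ.+ i) (r ℕ.+ m))))))
    first-letter-Δ : ∀ l s → ∑[ a + b ≡ s ] (choose s a * G l a b)
                             ≈ ρ* ps (λ km → ⟨ ΔH (s ℕ.+ proj₂ km) ∣ (λ ij → ψ (l ∷ proj₁ km) (proj₁ ij) (proj₂ ij)) ⟩)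
    first-letter-Δ l s = begin
      ∑[ a + b ≡ s ] (choose s a * G l a b)
        ≈⟨ ⟨ΔH∣⟩-binomial s (λ ab → G l (proj₁ ab) (proj₂ ab)) ⟨
      ⟨ ΔH s ∣ (λ ab → G l (proj₁ ab) (proj₂ ab)) ⟩
        ≈⟨ ρ*-⟨∣⟩ ps (ΔH s) _ ⟨
      ρ* ps (λ km → ⟨ ΔH s ∣ (λ ab → ⟨ ΔH (proj₂ km) ∣ (λ ij → ψ (l ∷ proj₁ km) (proj₁ ab ℕ.+ proj₁ ij) (proj₂ ab ℕ.+ proj₂ ij)) ⟩) ⟩)
        ≈⟨ ρ*-cong ps (λ km → ⟨ΔH-+∣⟩ s (proj₂ km) _) ⟨
      ρ* ps (λ km → ⟨ ΔH (s ℕ.+ proj₂ km) ∣ (λ ij → ψ (l ∷ proj₁ km) (proj₁ ij) (proj₂ ij)) ⟩) ∎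

  ρ*-counit : ∀ w (χ : Word → Carrier) → ρ* w (λ km → εH (proj₂ km) * χ (proj₁ km)) ≈ χ w
  ρ*-counit []       χ = *-identityˡ _
  ρ*-counit (p ∷ ps) χ = begin
    ∑[ j + r ≡ p ] (choose (suc p) (suc j) * ρ* ps (λ km → εH (r ℕ.+ proj₂ km) * χ (j ∷ proj₁ km)))
      ≈⟨ ∑₂-last p (λ j r → trans (*-congˡ (ρ*-0 ps (λ _ → trans (*-congʳ (zeroˡ _)) (zeroˡ _)))) (zeroʳ _)) ⟩
    choose (suc p) (suc p) * ρ* ps (λ km → εH (proj₂ km) * χ (p ∷ proj₁ km))
      ≈⟨ *-cong (choose-n-n (suc p)) (ρ*-counit ps (λ k → χ (p ∷ k))) ⟩
    1# * χ (p ∷ ps)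
      ≈⟨ *-identityˡ _ ⟩
    χ (p ∷ ps) ∎


  tupleSum : Word → (C⊗H-basis → Carrier) → Carrier
  tupleSum w φ = ∑[ k ← tuples w ] (ℕ→R K (binomProd w k) * φ (k , weight w ∸ weight k))

  tupleSum≈ρ* : ∀ w φ → tupleSum w φ ≈ ρ* w φ
  tupleSum≈ρ* []       φ = trans (+-identityʳ _) (trans (*-congʳ ℕ→R-1) (*-identityˡ _))
  tupleSum≈ρ* (p ∷ ps) φ = begin
    tupleSum (p ∷ ps) φ
      ≈⟨ ∑-concatMap (λ j → map (j ∷_) (tuples ps)) (upTo (suc p)) term ⟩
    ∑[ j ← upTo (suc p) ] ∑ (map (j ∷_) (tuples ps)) term
      ≈⟨ ∑-congᴬ (All.applyUpTo⁺₁ (λ j → j) (suc p) (λ j<1+p → j<1+p)) (λ { (s≤s j≤p) → first-letter j≤p }) ⟩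
    ∑[ j ← upTo (suc p) ] (choose (suc p) (suc j) * tupleSum ps (shift j (p ∸ j) φ))
      ≈⟨ ∑-cong (upTo (suc p)) (λ j → *-congˡ (tupleSum≈ρ* ps (shift j (p ∸ j) φ))) ⟩
    ∑[ j ← upTo (suc p) ] (choose (suc p) (suc j) * ρ* ps (shift j (p ∸ j) φ))
      ≈⟨ ∑₂≈∑-upTo p _ ⟨
    ρ* (p ∷ ps) φ ∎
    where
    term : Word → Carrier
    term k = ℕ→R K (binomProd (p ∷ ps) k) * φ (k , weight (p ∷ ps) ∸ weight k)
    first-letter : ∀ {j} → j ≤ p → ∑ (map (j ∷_) (tuples ps)) term ≈ choose (suc p) (suc j) * tupleSum ps (shift j (p ∸ j) φ)
    first-letter {j} j≤p = begin
      ∑ (map (j ∷_) (tuples ps)) term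
        ≡⟨ ∑-map (j ∷_) (tuples ps) term ⟩
      ∑[ k ← tuples ps ] term (j ∷ k)
        ≈⟨ ∑-congᴬ (tuples-weightIn ps) (λ { {k} (_ , s≤s wk≤W) → split-first-letter k wk≤W }) ⟩
      ∑[ k ← tuples ps ] (choose (suc p) (suc j) * (ℕ→R K (binomProd ps k) * shift j (p ∸ j) φ (k , weight ps ∸ weight k)))
        ≈⟨ *-distribˡ-∑ (tuples ps) _ _ ⟩
      choose (suc p) (suc j) * tupleSum ps (shift j (p ∸ j) φ) ∎
      where
      split-first-letter : ∀ k → weight k ≤ weight ps →
        term (j ∷ k) ≈ choose (suc p) (suc j) * (ℕ→R K (binomProd ps k) * shift j (p ∸ j) φ (k , weight ps ∸ weight k))
      split-first-letter k wk≤W = begin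
        ℕ→R K ((suc p C suc j) ℕ.* binomProd ps k) * φ (j ∷ k , (p ℕ.+ weight ps) ∸ (j ℕ.+ weight k))
          ≈⟨ *-cong (ℕ→R-homo-* (suc p C suc j) (binomProd ps k)) (reflexive (≡.cong (λ m → φ (j ∷ k , m)) (+-∸-interchange j≤p wk≤W))) ⟩
        choose (suc p) (suc j) * ℕ→R K (binomProd ps k) * φ (j ∷ k , (p ∸ j) ℕ.+ (weight ps ∸ weight k))
          ≈⟨ *-assoc _ _ _ ⟩
        choose (suc p) (suc j) * (ℕ→R K (binomProd ps k) * φ (j ∷ k , (p ∸ j) ℕ.+ (weight ps ∸ weight k))) ∎

  ⟨ρ-basis∣⟩≈tupleSum : ∀ p ps φ → ⟨ ρ-basis (p ∷ ps) ∣ φ ⟩ ≈ tupleSum (p ∷ ps) φ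
  ⟨ρ-basis∣⟩≈tupleSum p ps φ with tuples-split (p ∷ ps)
  ... | I , tuples≡I∷ʳw , I-light = begin
    ⟨ ρ-basis w ∣ φ ⟩
      ≈⟨ ∑-++ (concatMap S R) ((1# , (w , 0)) ∷ []) h ⟩
    ∑ (concatMap S R) h + (1# * φ (w , 0) + 0#)
      ≈⟨ +-cong (∑-concatMap S R h) (trans (+-identityʳ _) (*-identityˡ _)) ⟩
    ∑[ s ← R ] ∑ (S s) h + φ (w , 0)
      ≈⟨ +-congʳ (∑-cong R (λ s → trans (reflexive (∑-map _ (tuplesWithSum w s) h)) (∑-filterᵇ _ (tuples w) _))) ⟩
    ∑[ s ← R ] ∑[ k ← tuples w ] δ (weight k) (g k) s + φ (w , 0)
      ≈⟨ +-congʳ (∑-comm R (tuples w) _) ⟩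
    ∑[ k ← tuples w ] ∑ R (δ (weight k) (g k)) + φ (w , 0)
      ≡⟨ ≡.cong (λ ks → ∑[ k ← ks ] ∑ R (δ (weight k) (g k)) + φ (w , 0)) tuples≡I∷ʳw ⟩
    ∑[ k ← I ∷ʳ w ] ∑ R (δ (weight k) (g k)) + φ (w , 0)
      ≈⟨ +-congʳ (∑-∷ʳ I w _) ⟩
    ∑[ k ← I ] ∑ R (δ (weight k) (g k)) + ∑ R (δ W (g w)) + φ (w , 0)
      ≈⟨ +-congʳ (+-cong (∑-congᴬ I-light (λ { {k} (q≤wk , wk<W) → ∑-range-δ-in (weight k) (g k) q n q≤wk (≡.subst (weight k <_) (≡.sym q+n≡W) wk<W) }))
                         (∑-range-δ-out W (g w) q n (ℕ.≤-reflexive q+n≡W))) ⟩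
    ∑[ k ← I ] term k + 0# + φ (w , 0)
      ≈⟨ +-cong (+-identityʳ _) (sym term-w≈φ) ⟩
    ∑[ k ← I ] term k + term w
      ≈⟨ ∑-∷ʳ I w term ⟨
    ∑ (I ∷ʳ w) term
      ≡⟨ ≡.cong (λ ks → ∑ ks term) tuples≡I∷ʳw ⟨
    tupleSum w φ ∎
    where
    w = p ∷ ps
    W = weight w
    q = length w
    n = suc (W ∸ 1) ∸ q
    R = range q (W ∸ 1)
    S : ℕ → FS C⊗H-basis
    S s = map (λ k → (ℕ→R K (binomProd w k) , (k , W ∸ s))) (tuplesWithSum w s)
    h : Carrier × C⊗H-basis → Carrier
    h e = proj₁ e * φ (proj₂ e)
    g : Word → ℕ → Carrier
    g k s = ℕ→R K (binomProd w k) * φ (k , W ∸ s)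
    term : Word → Carrier
    term k = g k (weight k)
    q+n≡W : q ℕ.+ n ≡ W
    q+n≡W = ℕ.m+[n∸m]≡n (length≤weight w)
    term-w≈φ : term w ≈ φ (w , 0)
    term-w≈φ = begin
      ℕ→R K (binomProd w w) * φ (w , W ∸ W)   ≡⟨ ≡.cong₂ (λ b m → ℕ→R K b * φ (w , m)) (binomProd-self w) (ℕ.n∸n≡0 W) ⟩
      ℕ→R K 1 * φ (w , 0)                     ≈⟨ trans (*-congʳ ℕ→R-1) (*-identityˡ _) ⟩
      φ (w , 0)                               ∎

  ⟨ρ-basis∣⟩≈ρ* : ∀ w φ → ⟨ ρ-basis w ∣ φ ⟩ ≈ ρ* w φ
  ⟨ρ-basis∣⟩≈ρ* []       φ = trans (+-identityʳ _) (*-identityˡ _)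
  ⟨ρ-basis∣⟩≈ρ* (p ∷ ps) φ = trans (⟨ρ-basis∣⟩≈tupleSum p ps φ) (tupleSum≈ρ* (p ∷ ps) φ)

  ⟨ρ∣⟩ : ∀ x φ → ⟨ ρ x ∣ φ ⟩ ≈ ⟨ x ∣ (λ w → ρ* w φ) ⟩
  ⟨ρ∣⟩ x φ = trans (⟨linExt∣⟩ ρ-basis x φ) (⟨∣⟩-cong x (λ w → ⟨ρ-basis∣⟩≈ρ* w φ))

  ⟨ρ⊗Id∣⟩ : ∀ X ψ → ⟨ ρ⊗Id X ∣ ψ ⟩ ≈ ⟨ X ∣ (λ km → ρ* (proj₁ km) (λ li → ψ (proj₁ li , proj₂ li , proj₂ km))) ⟩
  ⟨ρ⊗Id∣⟩ X ψ = trans (⟨linExt∣⟩ _ X ψ) (⟨∣⟩-cong X (λ { (w , m) →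
    trans (reflexive (∑-map _ (ρ-basis w) _)) (⟨ρ-basis∣⟩≈ρ* w _) }))

  ⟨Id⊗Δ∣⟩ : ∀ X ψ → ⟨ Id⊗Δ X ∣ ψ ⟩ ≈ ⟨ X ∣ (λ km → ⟨ ΔH (proj₂ km) ∣ (λ ij → ψ (proj₁ km , proj₁ ij , proj₂ ij)) ⟩) ⟩
  ⟨Id⊗Δ∣⟩ X ψ = trans (⟨linExt∣⟩ _ X ψ) (⟨∣⟩-cong X (λ { (w , m) → reflexive (∑-map _ (ΔH m) _) }))

  ⟨Id⊗ε∣⟩ : ∀ X χ → ⟨ Id⊗ε X ∣ χ ⟩ ≈ ⟨ X ∣ (λ km → εH (proj₂ km) * χ (proj₁ km)) ⟩
  ⟨Id⊗ε∣⟩ []                  χ = refl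
  ⟨Id⊗ε∣⟩ ((a , (w , m)) ∷ xs) χ = +-cong (*-assoc a (εH m) (χ w)) (⟨Id⊗ε∣⟩ xs χ)

  coassociativity : ∀ x → ρ⊗Id (ρ x) ≋CHH Id⊗Δ (ρ x)
  coassociativity x = ⟨∣⟩⇒Eq _≟CHH_ {ρ⊗Id (ρ x)} {Id⊗Δ (ρ x)} λ ψ → begin
    ⟨ ρ⊗Id (ρ x) ∣ ψ ⟩                                  ≈⟨ ⟨ρ⊗Id∣⟩ (ρ x) ψ ⟩
    ⟨ ρ x ∣ Φ₁ ψ ⟩                                       ≈⟨ ⟨ρ∣⟩ x (Φ₁ ψ) ⟩
    ⟨ x ∣ (λ w → ρ* w (Φ₁ ψ)) ⟩                          ≈⟨ ⟨∣⟩-cong x (λ w → ρ*-coassoc w (λ l i m → ψ (l , i , m))) ⟩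
    ⟨ x ∣ (λ w → ρ* w (Φ₂ ψ)) ⟩                          ≈⟨ ⟨ρ∣⟩ x (Φ₂ ψ) ⟨
    ⟨ ρ x ∣ Φ₂ ψ ⟩                                       ≈⟨ ⟨Id⊗Δ∣⟩ (ρ x) ψ ⟨
    ⟨ Id⊗Δ (ρ x) ∣ ψ ⟩                                  ∎
    where
    Φ₁ Φ₂ : (C⊗H⊗H-basis → Carrier) → C⊗H-basis → Carrier
    Φ₁ ψ km = ρ* (proj₁ km) (λ li → ψ (proj₁ li , proj₂ li , proj₂ km))
    Φ₂ ψ km = ⟨ ΔH (proj₂ km) ∣ (λ ij → ψ (proj₁ km , proj₁ ij , proj₂ ij)) ⟩

  counitality : ∀ x → Id⊗ε (ρ x) ≋C x
  counitality x = ⟨∣⟩⇒Eq _≟C_ {Id⊗ε (ρ x)} {x} λ χ → begin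
    ⟨ Id⊗ε (ρ x) ∣ χ ⟩                                  ≈⟨ ⟨Id⊗ε∣⟩ (ρ x) χ ⟩
    ⟨ ρ x ∣ (λ km → εH (proj₂ km) * χ (proj₁ km)) ⟩     ≈⟨ ⟨ρ∣⟩ x _ ⟩
    ⟨ x ∣ (λ w → ρ* w (λ km → εH (proj₂ km) * χ (proj₁ km))) ⟩ ≈⟨ ⟨∣⟩-cong x (λ w → ρ*-counit w χ) ⟩
    ⟨ x ∣ χ ⟩                                            ∎

mainTheorem11 : ∀ {c ℓ} (K : CommutativeRing c ℓ) → IsField K → CharacteristicZero K →
    let open Comodule K in
    ∀ (x : FS Word) →
      (ρ⊗Id (ρ x) ≋CHH Id⊗Δ (ρ x)) × (Id⊗ε (ρ x) ≋C x)
mainTheorem11 K _ _ x = coassociativity K x , counitality K x
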